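{- Let $X,Y$ be nonempty sets and $h,f,g\in\mathcal{P}(X,Y)$. Then $h=f[g]$ if and only if all of the following hold: $h\sqcup f=h$, $f\sqcup h=f$, $h\sqcup g=g\sqcup h$, and $g\sqcup f=g\sqcup h$. In particular, update is abstractly definable from override by the formula $\phi_1(x,x_1,x_2)$ given by the conjunction $x\sqcup x_1=x\ \&\ x_1\sqcup x=x_1\ \&\ x\sqcup x_2=x_2\sqcup x\ \&\ x_2\sqcup x_1=x_2\sqcup x$.
   Context: $\mathcal{P}(X,Y)$ is the set of partial functions from $X$ to $Y$. Override: $(f\sqcup g)(x)=f(x)$ if $x\in\mathrm{dom}(f)$, $=g(x)$ if $x\in\mathrm{dom}(g)\setminus\mathrm{dom}(f)$, undefined otherwise. Update: $f[g]$ is the restriction of $g\sqcup f$ to $\mathrm{dom}(f)$. An $n$-ary operation $\divideontimes$ on partial functions is abstractly definable from a set of operations by a first-order formula $\phi(x,x_1,\dots,x_n)$ in that signature if in every concrete algebra of partial functions in that signature (not necessarily closed under $\divideontimes$) one has $h=\divideontimes(f_1,\dots,f_n)$ iff $\phi(h,f_1,\dots,f_n)$ holds. -}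

module Defs where

open import Data.Maybe using (Maybe; just; nothing)
open import Relation.Binary.PropositionalEquality using (_≡_)

-- A partial function X ⇀ Y is a total function X → Maybe Y
-- (nothing = undefined at that point).
PFun : Set → Set → Set
PFun X Y = X → Maybe Y

-- Equality of partial functions (as sets of pairs) = pointwise equality
-- (extensional; no funext in --safe Agda).
_≐_ : {X Y : Set} → PFun X Y → PFun X Y → Set
f ≐ g = ∀ x → f x ≡ g x

infix 4 _≐_

_⊔_ : {X Y : Set} → PFun X Y → PFun X Y → PFun X Y
(f ⊔ g) x with f x
... | just y  = just y
... | nothing = g x

infixl 6 _⊔_

_[_] : {X Y : Set} → PFun X Y → PFun X Y → PFun X Y
(f [ g ]) x with f x
... | nothing = nothing
... | just _  = (g ⊔ f) x

module Submission where

-- Both operations are pointwise: at each argument x, (f ⊔ g) x is the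
-- "first defined value" f x <∣> g x, and (f [ g ]) x is a function of the
-- two values f x and g x alone, called `update` below.  So the theorem is a
-- statement about three values h, f, g : Maybe Y at a single point:
--   h ≡ update f g   iff   h <∣> f ≡ h,  f <∣> h ≡ f,
--                          h <∣> g ≡ g <∣> h,  g <∣> f ≡ g <∣> h,
-- which is checked by case analysis on which of the values are defined
-- (`update-conditions`).

open import Defs
open import Data.Maybe using (Maybe; just; nothing; _<∣>_)
open import Data.Product using (_×_; _,_; proj₁; proj₂)
open import Data.Product.Function.NonDependent.Propositional using (_×-⇔_)
open import Function.Bundles using (_⇔_; mk⇔; Equivalence)
import Function.Properties.Equivalence as ⇔
open import Relation.Binary.PropositionalEquality using (_≡_; refl; sym; trans)

private
  variable
    X Y : Set

override-at : (f g : PFun X Y) (x : X) → (f ⊔ g) x ≡ f x <∣> g x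
override-at f g x with f x
... | just _  = refl
... | nothing = refl

update : Maybe Y → Maybe Y → Maybe Y
update nothing  _ = nothing
update (just a) b = b <∣> just a

update-at : (f g : PFun X Y) (x : X) → (f [ g ]) x ≡ update (f x) (g x)
update-at f g x with f x in fx≡
... | nothing = refl
... | just _ with g x
...   | just _  = refl
...   | nothing = fx≡

UpdateConditions : (h f g : Maybe Y) → Set
UpdateConditions h f g =
  (h <∣> f ≡ h) × (f <∣> h ≡ f) × (h <∣> g ≡ g <∣> h) × (g <∣> f ≡ g <∣> h)

update-conditions : (h f g : Maybe Y) → h ≡ update f g ⇔ UpdateConditions h f g
update-conditions h f g = mk⇔ (λ { refl → sound f g }) (complete h f g)
  where
  sound : (f g : Maybe Y) → UpdateConditions (update f g) f g
  sound nothing  nothing  = refl , refl , refl , refl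
  sound nothing  (just _) = refl , refl , refl , refl
  sound (just _) nothing  = refl , refl , refl , refl
  sound (just _) (just _) = refl , refl , refl , refl

  -- h and f have the same domain by the first two equations; the last
  -- two then pin down h's value as g's (if defined) or f's.
  complete : (h f g : Maybe Y) → UpdateConditions h f g → h ≡ update f g
  complete nothing  nothing  _        _                      = refl
  complete (just _) nothing  _        (_ , () , _ , _)
  complete nothing  (just _) _        (() , _ , _ , _)
  complete (just _) (just _) nothing  (_ , _ , _ , g⊔f≡g⊔h) = sym g⊔f≡g⊔h
  complete (just _) (just _) (just _) (_ , _ , h⊔g≡g⊔h , _) = h⊔g≡g⊔h

≐-cong : {F F′ G G′ : PFun X Y} → F ≐ F′ → G ≐ G′ → (F ≐ G) ⇔ (F′ ≐ G′)
≐-cong F≐F′ G≐G′ = mk⇔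
  (λ F≐G x → trans (sym (F≐F′ x)) (trans (F≐G x) (G≐G′ x)))
  (λ F′≐G′ x → trans (F≐F′ x) (trans (F′≐G′ x) (sym (G≐G′ x))))

∀-distrib-×⁴ : {A B C D : X → Set} →
  (∀ x → A x × B x × C x × D x) ⇔
  ((∀ x → A x) × (∀ x → B x) × (∀ x → C x) × (∀ x → D x))
∀-distrib-×⁴ = mk⇔
  (λ p → (λ x → proj₁ (p x)) , (λ x → proj₁ (proj₂ (p x)))
       , (λ x → proj₁ (proj₂ (proj₂ (p x)))) , (λ x → proj₂ (proj₂ (proj₂ (p x)))))
  (λ { (a , b , c , d) x → a x , b x , c x , d x })

∀-cong-⇔ : {A B : X → Set} → (∀ x → A x ⇔ B x) → (∀ x → A x) ⇔ (∀ x → B x)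
∀-cong-⇔ A⇔B = mk⇔ (λ a x → Equivalence.to (A⇔B x) (a x))
                    (λ b x → Equivalence.from (A⇔B x) (b x))

override-conditions : (h f g : PFun X Y) →
  (∀ x → UpdateConditions (h x) (f x) (g x)) ⇔
  ((h ⊔ f ≐ h) × (f ⊔ h ≐ f) × (h ⊔ g ≐ g ⊔ h) × (g ⊔ f ≐ g ⊔ h))
override-conditions h f g = ⇔.trans ∀-distrib-×⁴
  (       ⇔.sym (≐-cong (override-at h f) (λ _ → refl))
    ×-⇔ ⇔.sym (≐-cong (override-at f h) (λ _ → refl))
    ×-⇔ ⇔.sym (≐-cong (override-at h g) (override-at g h))
    ×-⇔ ⇔.sym (≐-cong (override-at g f) (override-at g h)))

lemma3p6 : {X Y : Set} → X → Y → (h f g : PFun X Y) →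
    (h ≐ f [ g ]) ⇔ ((h ⊔ f ≐ h) × (f ⊔ h ≐ f) × (h ⊔ g ≐ g ⊔ h) × (g ⊔ f ≐ g ⊔ h))
lemma3p6 _ _ h f g =
  ⇔.trans (≐-cong (λ _ → refl) (update-at f g))
  (⇔.trans (∀-cong-⇔ (λ x → update-conditions (h x) (f x) (g x)))
           (override-conditions h f g))
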